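{- Let $p\neq q$ be coprime positive integers satisfying $$5\,q^{3}-\frac{q^{3}}{3600^{3}}\leqslant p\leqslant 5\,q^{3}+\frac{q^{3}}{3600^{3}}\qquad\text{and}\qquad 5\,q^{3}-2q<p<5\,q^{3}+2q.$$ Then the tenth degree cuboid characteristic equation $Q_{pq}(t)=0$ produces no perfect cuboids, i.e. there is no positive integer $t$ such that the triple $(p,q,t)$ produces a perfect cuboid.
   Context: For integers $p,q$ the polynomial $Q_{pq}(t)\in\mathbb Z[t]$ is $$Q_{pq}(t)=t^{10}+(2q^{2}+p^{2})(3q^{2}-2p^{2})\,t^{8}+(q^{8}+10p^{2}q^{6}+4p^{4}q^{4}-14p^{6}q^{2}+p^{8})\,t^{6}-p^{2}q^{2}(q^{8}-14p^{2}q^{6}+4p^{4}q^{4}+10p^{6}q^{2}+p^{8})\,t^{4}-p^{6}q^{6}(q^{2}+2p^{2})(3p^{2}-2q^{2})\,t^{2}-q^{10}p^{10}.$$ A triple of positive integers $(p,q,t)$ with $p\neq q$ coprime is said to produce a perfect cuboid (a rectangular box with integer edges, integer face diagonals and integer space diagonal) exactly when $Q_{pq}(t)=0$ and $t>p^{2}$, $t>pq$, $t>q^{2}$, $(p^{2}+t)(pq+t)>2t^{2}$. -}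

module Defs where

open import Data.Nat using (ℕ)
open import Data.Integer using (ℤ; +_; _+_; _-_; _*_; -_; _^_; _<_; _≤_)
open import Data.Nat.Coprimality using (Coprime)
open import Data.Product using (_×_)
open import Relation.Binary.PropositionalEquality using (_≡_)

Q : ℤ → ℤ → ℤ → ℤ
Q p q t =
    t ^ 10
  + (+ 2 * q ^ 2 + p ^ 2) * (+ 3 * q ^ 2 - + 2 * p ^ 2) * t ^ 8
  + (q ^ 8 + + 10 * p ^ 2 * q ^ 6 + + 4 * p ^ 4 * q ^ 4 - + 14 * p ^ 6 * q ^ 2 + p ^ 8) * t ^ 6
  - p ^ 2 * q ^ 2 * (q ^ 8 - + 14 * p ^ 2 * q ^ 6 + + 4 * p ^ 4 * q ^ 4 + + 10 * p ^ 6 * q ^ 2 + p ^ 8) * t ^ 4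
  - p ^ 6 * q ^ 6 * (q ^ 2 + + 2 * p ^ 2) * (+ 3 * p ^ 2 - + 2 * q ^ 2) * t ^ 2
  - q ^ 10 * p ^ 10

ProducesCuboid : ℕ → ℕ → ℕ → Set
ProducesCuboid p q t =
  let P = + p ; R = + q ; T = + t in
  (Q P R T ≡ + 0)
  × (P ^ 2 < T) × (P * R < T) × (R ^ 2 < T)
  × (+ 2 * T ^ 2 < (P ^ 2 + T) * (P * R + T))

-- Write t = p² + s.  Then Q(p, q, p² + s) = c₀ + c₁ s + … + c₁₀ s¹⁰ with cₖ polynomials in p, q,
-- and for p ≥ 8q one has c₀ ≤ 0 and c₂, …, c₁₀ ≥ 0, so that Q(p, q, p² + s)/s is nondecreasing
-- in s > 0.  Let S = pivot p q = 2pq − 2q².  When q ≥ 1 and pMin q = 5q³ − 2q + 1 ≤ p, the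
-- cuboid inequality (p² + t)(pq + t) > 2t² forces s ≤ S + 1, and Q(p, q, p² + S + 1) > 0; when
-- moreover q ≥ 2 (so p ≥ 8q) also Q(p, q, p² + S) < 0, hence Q(p, q, p² + s) < 0 for 0 < s ≤ S.  For q = 1 the bounds leave p ∈ {4, 5, 6}, which are
-- checked by evaluation.  Every polynomial inequality is certified by expanding it in nonnegative variables
-- and checking that all coefficients are nonnegative.

module Submission where

open import Defs
open import Data.Nat using (ℕ; suc; z≤n; s≤s)
open import Data.Integer using (+_; _+_; _-_; -_; _*_; _^_; _<_; _≤_)
open import Data.Nat.Coprimality using (Coprime)
open import Data.Product using (_×_)
open import Relation.Binary.PropositionalEquality using (_≢_)
open import Relation.Nullary using (¬_)

import Data.Nat as ℕ
open import Data.Nat.Properties using (allUpTo?)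
open import Data.Bool using (Bool; true; _∧_; T)
open import Data.Bool.Properties using (T-∧)
open import Data.Bool.ListAction using (all)
open import Data.Empty using (⊥-elim)
open import Data.Fin using (zero; suc)
open import Data.Integer using (ℤ; 0ℤ; 1ℤ; +≤+; _≤?_; _≟_) renaming (suc to sucℤ)
open import Data.Integer.Base using (nonNegative; positive)
open import Data.Integer.Properties
  using (≤-refl; ≤-trans; ≤-antisym; <⇒≤; <-irrefl; <-≤-trans; ≰⇒>; <⇒≢; i<j⇒suc[i]≤j; suc[i]≤j⇒i<j;
         i≤j⇒0≤j-i; 0≤i-j⇒j≤i; +-mono-≤; +-monoʳ-≤; +-monoˡ-<; +-inverseʳ; *-zeroʳ; neg-mono-≤;
         *-monoʳ-≤-nonNeg; *-monoˡ-≤-nonNeg; *-monoˡ-<-pos; *-cancelˡ-<-nonNeg; drop‿+≤+; drop‿+<+;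
         module ≤-Reasoning)
open import Data.Integer.Solver using (module +-*-Solver)
open import Data.List using (List; []; _∷_; map)
open import Data.List.Relation.Unary.All using (All; []; _∷_)
open import Data.List.Relation.Unary.All.Properties using (all⁺)
open import Data.Maybe using (is-just; to-witness-T)
open import Data.Product using (Σ-syntax; _,_)
open import Data.Sum using (_⊎_; inj₁; inj₂; [_,_]′)
open import Data.Vec using ([]; _∷_)
import Data.Vec.Relation.Unary.All as VecAll
open VecAll using ([]; _∷_)
open import Function using (_∘_)
open import Function.Bundles using (Equivalence)
open import Relation.Binary.PropositionalEquality using (_≡_; refl; sym; subst; subst₂; ≢-sym; module ≡-Reasoning)
open import Relation.Nullary using (yes; no)
open import Relation.Nullary.Decidable using (True; toWitness; isYes; ¬?)

open +-*-Solver

private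
  variable
    n : ℕ

0≤* : ∀ {a b} → 0ℤ ≤ a → 0ℤ ≤ b → 0ℤ ≤ a * b
0≤* {b = b} 0≤a 0≤b = *-monoʳ-≤-nonNeg b {{nonNegative 0≤b}} 0≤a

≡-byNormalForms : ∀ (e₁ e₂ : Polynomial n) → T (is-just (normalise e₁ ≟N normalise e₂)) →
                  ∀ ρ → ⟦ e₁ ⟧ ρ ≡ ⟦ e₂ ⟧ ρ
≡-byNormalForms e₁ e₂ e₁≈e₂ ρ = begin
  ⟦ e₁ ⟧ ρ             ≡⟨ correct e₁ ρ ⟨
  ⟦ normalise e₁ ⟧N ρ  ≡⟨ ⟦ to-witness-T (normalise e₁ ≟N normalise e₂) e₁≈e₂ ⟧N-cong ρ ⟩
  ⟦ normalise e₂ ⟧N ρ  ≡⟨ correct e₂ ρ ⟩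
  ⟦ e₂ ⟧ ρ             ∎
  where open ≡-Reasoning

mutual
  nonNegCoeffsH : HNF (suc n) → Bool
  nonNegCoeffsH ∅         = true
  nonNegCoeffsH (p *x+ c) = nonNegCoeffsH p ∧ nonNegCoeffsN c

  nonNegCoeffsN : Normal n → Bool
  nonNegCoeffsN (con c)  = isYes (0ℤ ≤? c)
  nonNegCoeffsN (poly p) = nonNegCoeffsH p

mutual
  nonNegCoeffsH-sound : ∀ p {ρ : Env (suc n)} → VecAll.All (0ℤ ≤_) ρ → T (nonNegCoeffsH p) → 0ℤ ≤ ⟦ p ⟧H ρ
  nonNegCoeffsH-sound ∅         _           _  = ≤-refl
  nonNegCoeffsH-sound (p *x+ c) (0≤x ∷ 0≤ρ) ok =
    let okp , okc = Equivalence.to (T-∧ {nonNegCoeffsH p}) ok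
    in +-mono-≤ (0≤* (nonNegCoeffsH-sound p (0≤x ∷ 0≤ρ) okp) 0≤x) (nonNegCoeffsN-sound c 0≤ρ okc)

  nonNegCoeffsN-sound : ∀ p {ρ : Env n} → VecAll.All (0ℤ ≤_) ρ → T (nonNegCoeffsN p) → 0ℤ ≤ ⟦ p ⟧N ρ
  nonNegCoeffsN-sound (con c)  _   ok = toWitness ok
  nonNegCoeffsN-sound (poly p) 0≤ρ ok = nonNegCoeffsH-sound p 0≤ρ ok

NonNegCoeffs : Polynomial n → Set
NonNegCoeffs e = T (nonNegCoeffsN (normalise e))

nonNegCoeffs⇒0≤ : ∀ (e : Polynomial n) ρ → NonNegCoeffs e → VecAll.All (0ℤ ≤_) ρ → 0ℤ ≤ ⟦ e ⟧ ρ
nonNegCoeffs⇒0≤ e ρ ok 0≤ρ = subst (0ℤ ≤_) (correct e ρ) (nonNegCoeffsN-sound (normalise e) 0≤ρ ok)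

nonNegCoeffs⇒≤ : ∀ (e₁ e₂ : Polynomial n) ρ → NonNegCoeffs (e₂ :- e₁) → VecAll.All (0ℤ ≤_) ρ →
                 ⟦ e₁ ⟧ ρ ≤ ⟦ e₂ ⟧ ρ
nonNegCoeffs⇒≤ e₁ e₂ ρ ok 0≤ρ = 0≤i-j⇒j≤i (nonNegCoeffs⇒0≤ (e₂ :- e₁) ρ ok 0≤ρ)

nonNegCoeffs⇒< : ∀ (e₁ e₂ : Polynomial n) ρ → NonNegCoeffs (e₂ :- (con 1ℤ :+ e₁)) → VecAll.All (0ℤ ≤_) ρ →
                 ⟦ e₁ ⟧ ρ < ⟦ e₂ ⟧ ρ
nonNegCoeffs⇒< e₁ e₂ ρ ok 0≤ρ = suc[i]≤j⇒i<j (nonNegCoeffs⇒≤ (con 1ℤ :+ e₁) e₂ ρ ok 0≤ρ)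

nonNegCoeffs⇒All0≤ : ∀ (es : List (Polynomial n)) ρ → T (all (nonNegCoeffsN ∘ normalise) es) →
                     VecAll.All (0ℤ ≤_) ρ → All (0ℤ ≤_) (map (λ e → ⟦ e ⟧ ρ) es)
nonNegCoeffs⇒All0≤ es ρ ok 0≤ρ = go es (all⁺ _ es ok)
  where
    go : ∀ es → All NonNegCoeffs es → All (0ℤ ≤_) (map (λ e → ⟦ e ⟧ ρ) es)
    go []       []         = []
    go (e ∷ es) (ok ∷ oks) = nonNegCoeffs⇒0≤ e ρ ok 0≤ρ ∷ go es oks

offset : ∀ {i j} → i ≤ j → Σ[ d ∈ ℤ ] 0ℤ ≤ d × j ≡ i + d
offset {i} {j} i≤j = j - i , i≤j⇒0≤j-i i≤j , solve 2 (λ i j → j := i :+ (j :- i)) refl i j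

≤-elim : ∀ {i j} → i ≤ j → (P : ℤ → Set) → (∀ d → 0ℤ ≤ d → P (i + d)) → P j
≤-elim i≤j P P[i+_] = let d , 0≤d , j≡i+d = offset i≤j in subst P (sym j≡i+d) (P[i+_] d 0≤d)

≤-elim² : ∀ {p q} (b : ℤ → ℤ) (P : ℤ → ℤ → Set) → 1ℤ ≤ q → b q ≤ p →
          (∀ a g → 0ℤ ≤ a → 0ℤ ≤ g → P (b (1ℤ + a) + g) (1ℤ + a)) → P p q
≤-elim² b P 1≤q b≤p P[b+] =
  ≤-elim 1≤q (λ q → ∀ {p} → b q ≤ p → P p q)
    (λ a 0≤a b≤p → ≤-elim b≤p (λ p → P p (1ℤ + a)) (λ g → P[b+] a g 0≤a)) b≤p

≤-suc-cases : ∀ {i j} → i ≤ sucℤ j → i ≤ j ⊎ i ≡ sucℤ j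
≤-suc-cases {i} {j} i≤1+j with i ≤? j
... | yes i≤j = inj₁ i≤j
... | no  i≰j = inj₂ (≤-antisym i≤1+j (i<j⇒suc[i]≤j (≰⇒> i≰j)))

i<j⇒0<j-i : ∀ {i j} → i < j → 0ℤ < j - i
i<j⇒0<j-i {i} {j} i<j = subst (_< j - i) (+-inverseʳ i) (+-monoˡ-< (- i) i<j)

horner : List ℤ → ℤ → ℤ
horner []       x = 0ℤ
horner (c ∷ cs) x = c + x * horner cs x

horner-nonNeg : ∀ {cs x} → All (0ℤ ≤_) cs → 0ℤ ≤ x → 0ℤ ≤ horner cs x
horner-nonNeg []           0≤x = ≤-refl
horner-nonNeg (0≤c ∷ 0≤cs) 0≤x = +-mono-≤ 0≤c (0≤* 0≤x (horner-nonNeg 0≤cs 0≤x))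

mutual
  horner-mono-≤ : ∀ {cs x y} → All (0ℤ ≤_) cs → 0ℤ ≤ x → x ≤ y → horner cs x ≤ horner cs y
  horner-mono-≤ {[]}     []         0≤x x≤y = ≤-refl
  horner-mono-≤ {c ∷ cs} (_ ∷ 0≤cs) 0≤x x≤y = +-monoʳ-≤ c (*horner-mono-≤ 0≤cs 0≤x x≤y)

  *horner-mono-≤ : ∀ {cs x y} → All (0ℤ ≤_) cs → 0ℤ ≤ x → x ≤ y → x * horner cs x ≤ y * horner cs y
  *horner-mono-≤ {cs} {x} {y} 0≤cs 0≤x x≤y = begin
    x * horner cs x  ≤⟨ *-monoʳ-≤-nonNeg (horner cs x) {{nonNegative (horner-nonNeg 0≤cs 0≤x)}} x≤y ⟩
    y * horner cs x  ≤⟨ *-monoˡ-≤-nonNeg y {{nonNegative (≤-trans 0≤x x≤y)}} (horner-mono-≤ 0≤cs 0≤x x≤y) ⟩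
    y * horner cs y  ∎
    where open ≤-Reasoning

-- f(x)/x = c₀/x + c₁ + x·h(x) is nondecreasing for x > 0.
horner-negative-below : ∀ {c₀ c₁ cs x y} → c₀ ≤ 0ℤ → All (0ℤ ≤_) cs → 0ℤ < x → x ≤ y →
                        horner (c₀ ∷ c₁ ∷ cs) y < 0ℤ → horner (c₀ ∷ c₁ ∷ cs) x < 0ℤ
horner-negative-below {c₀} {c₁} {cs} {x} {y} c₀≤0 0≤cs 0<x x≤y fy<0 =
  *-cancelˡ-<-nonNeg y {{nonNegative 0≤y}} (begin-strict
    y * f x  ≤⟨ 0≤i-j⇒j≤i (subst (0ℤ ≤_) (sym gap) (+-mono-≤ 0≤[y-x][-c₀] 0≤xy[yhy-xhx])) ⟩
    x * f y  <⟨ *-monoˡ-<-pos x {{positive 0<x}} fy<0 ⟩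
    x * 0ℤ   ≡⟨ *-zeroʳ x ⟩
    0ℤ       ≡⟨ *-zeroʳ y ⟨
    y * 0ℤ   ∎)
  where
    open ≤-Reasoning
    f : ℤ → ℤ
    f = horner (c₀ ∷ c₁ ∷ cs)
    0≤x : 0ℤ ≤ x
    0≤x = <⇒≤ 0<x
    0≤y : 0ℤ ≤ y
    0≤y = ≤-trans 0≤x x≤y
    0≤[y-x][-c₀] : 0ℤ ≤ (y - x) * - c₀
    0≤[y-x][-c₀] = 0≤* (i≤j⇒0≤j-i x≤y) (neg-mono-≤ c₀≤0)
    0≤xy[yhy-xhx] : 0ℤ ≤ (x * y) * (y * horner cs y - x * horner cs x)
    0≤xy[yhy-xhx] = 0≤* (0≤* 0≤x 0≤y) (i≤j⇒0≤j-i (*horner-mono-≤ 0≤cs 0≤x x≤y))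
    gap : x * f y - y * f x ≡ (y - x) * - c₀ + (x * y) * (y * horner cs y - x * horner cs x)
    gap = solve 6 (λ x y c₀ c₁ hx hy →
            x :* (c₀ :+ y :* (c₁ :+ y :* hy)) :- y :* (c₀ :+ x :* (c₁ :+ x :* hx))
              := (y :- x) :* (:- c₀) :+ (x :* y) :* (y :* hy :- x :* hx))
            refl x y c₀ c₁ (horner cs x) (horner cs y)

-- Each ⌜f⌝ is a syntactic copy of the integer function f: ⟦ ⌜f⌝ x y ⟧ ρ reduces to f ⟦ x ⟧ ρ ⟦ y ⟧ ρ.
⌜Q⌝ : Polynomial n → Polynomial n → Polynomial n → Polynomial n
⌜Q⌝ p q t =
     t :^ 10
  :+ (con (+ 2) :* q :^ 2 :+ p :^ 2) :* (con (+ 3) :* q :^ 2 :- con (+ 2) :* p :^ 2) :* t :^ 8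
  :+ (q :^ 8 :+ con (+ 10) :* p :^ 2 :* q :^ 6 :+ con (+ 4) :* p :^ 4 :* q :^ 4 :- con (+ 14) :* p :^ 6 :* q :^ 2 :+ p :^ 8) :* t :^ 6
  :- p :^ 2 :* q :^ 2 :* (q :^ 8 :- con (+ 14) :* p :^ 2 :* q :^ 6 :+ con (+ 4) :* p :^ 4 :* q :^ 4 :+ con (+ 10) :* p :^ 6 :* q :^ 2 :+ p :^ 8) :* t :^ 4
  :- p :^ 6 :* q :^ 6 :* (q :^ 2 :+ con (+ 2) :* p :^ 2) :* (con (+ 3) :* p :^ 2 :- con (+ 2) :* q :^ 2) :* t :^ 2
  :- q :^ 10 :* p :^ 10

pMin : ℤ → ℤ
pMin q = 1ℤ + (+ 5 * q ^ 3 - + 2 * q)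

⌜pMin⌝ : Polynomial n → Polynomial n
⌜pMin⌝ q = con 1ℤ :+ (con (+ 5) :* q :^ 3 :- con (+ 2) :* q)

pivot : ℤ → ℤ → ℤ
pivot p q = + 2 * p * q - + 2 * q ^ 2

⌜pivot⌝ : Polynomial n → Polynomial n → Polynomial n
⌜pivot⌝ p q = con (+ 2) :* p :* q :- con (+ 2) :* q :^ 2

⌜c₀⌝ ⌜c₁⌝ : Polynomial n → Polynomial n → Polynomial n
⌜c₀⌝ p q = con (+ 16) :* p :^ 12 :* q :^ 2 :* (q :^ 6 :- p :^ 6)
⌜c₁⌝ p q = con (+ 32) :* p :^ 10 :* q :^ 2 :* (con (+ 2) :* q :^ 6 :+ p :^ 2 :* q :^ 4 :+ p :^ 4 :* q :^ 2 :- con (+ 3) :* p :^ 6)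

⌜higherCoeffs⌝ : Polynomial n → Polynomial n → List (Polynomial n)
⌜higherCoeffs⌝ p q =
    con (+ 4) :* p :^ 16 :- con (+ 244) :* p :^ 14 :* q :^ 2 :+ con (+ 168) :* p :^ 12 :* q :^ 4 :+ con (+ 120) :* p :^ 10 :* q :^ 6 :+ con (+ 100) :* p :^ 8 :* q :^ 8 :- con (+ 4) :* p :^ 6 :* q :^ 10
  ∷ con (+ 28) :* p :^ 14 :- con (+ 340) :* p :^ 12 :* q :^ 2 :+ con (+ 376) :* p :^ 10 :* q :^ 4 :+ con (+ 184) :* p :^ 8 :* q :^ 6 :+ con (+ 76) :* p :^ 6 :* q :^ 8 :- con (+ 4) :* p :^ 4 :* q :^ 10
  ∷ con (+ 85) :* p :^ 12 :- con (+ 281) :* p :^ 10 :* q :^ 2 :+ con (+ 470) :* p :^ 8 :* q :^ 4 :+ con (+ 146) :* p :^ 6 :* q :^ 6 :+ con (+ 29) :* p :^ 4 :* q :^ 8 :- p :^ 2 :* q :^ 10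
  ∷ con (+ 146) :* p :^ 10 :- con (+ 140) :* p :^ 8 :* q :^ 2 :+ con (+ 360) :* p :^ 6 :* q :^ 4 :+ con (+ 60) :* p :^ 4 :* q :^ 6 :+ con (+ 6) :* p :^ 2 :* q :^ 8
  ∷ con (+ 155) :* p :^ 8 :- con (+ 42) :* p :^ 6 :* q :^ 2 :+ con (+ 172) :* p :^ 4 :* q :^ 4 :+ con (+ 10) :* p :^ 2 :* q :^ 6 :+ q :^ 8
  ∷ con (+ 104) :* p :^ 6 :- con (+ 8) :* p :^ 4 :* q :^ 2 :+ con (+ 48) :* p :^ 2 :* q :^ 4
  ∷ con (+ 43) :* p :^ 4 :- p :^ 2 :* q :^ 2 :+ con (+ 6) :* q :^ 4
  ∷ con (+ 10) :* p :^ 2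
  ∷ con 1ℤ
  ∷ []

⌜horner⌝ : List (Polynomial n) → Polynomial n → Polynomial n
⌜horner⌝ []       x = con 0ℤ
⌜horner⌝ (c ∷ cs) x = c :+ x :* ⌜horner⌝ cs x

at : Polynomial 2 → ℤ → ℤ → ℤ
at e p q = ⟦ e ⟧ (p ∷ q ∷ [])

c₀ c₁ : ℤ → ℤ → ℤ
c₀ = at (⌜c₀⌝ (var zero) (var (suc zero)))
c₁ = at (⌜c₁⌝ (var zero) (var (suc zero)))

higherCoeffs : ℤ → ℤ → List ℤ
higherCoeffs p q = map (λ c → at c p q) (⌜higherCoeffs⌝ (var zero) (var (suc zero)))

-- Comparing normal forms directly is much faster here than `solve`.
Q-shift : ∀ p q s → Q p q (p ^ 2 + s) ≡ horner (c₀ p q ∷ c₁ p q ∷ higherCoeffs p q) s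
Q-shift p q s = ≡-byNormalForms (⌜Q⌝ 𝕡 𝕢 (𝕡 :^ 2 :+ 𝕤)) (⌜horner⌝ (⌜c₀⌝ 𝕡 𝕢 ∷ ⌜c₁⌝ 𝕡 𝕢 ∷ ⌜higherCoeffs⌝ 𝕡 𝕢) 𝕤)
                                _ (p ∷ q ∷ s ∷ [])
  where
    𝕡 𝕢 𝕤 : Polynomial 3
    𝕡 = var zero
    𝕢 = var (suc zero)
    𝕤 = var (suc (suc zero))

-- A certificate is checked in nonnegative variables and moved to the integers it speaks about
-- along equations ⟦ 𝕡 ⟧ ρ ≡ p; asking for the conversion directly makes Agda unfold Q and the
-- coefficients, which exhausts memory.

coefficient-signs-certificate : ∀ q d → 0ℤ ≤ q → 0ℤ ≤ d →
                                c₀ (+ 8 * q + d) q ≤ 0ℤ × All (0ℤ ≤_) (higherCoeffs (+ 8 * q + d) q)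
coefficient-signs-certificate q d 0≤q 0≤d =
  subst (λ p → c₀ p q ≤ 0ℤ × All (0ℤ ≤_) (higherCoeffs p q)) p≡
    ( nonNegCoeffs⇒≤ (⌜c₀⌝ 𝕡 𝕢) (con 0ℤ) (q ∷ d ∷ []) _ (0≤q ∷ 0≤d ∷ [])
    , nonNegCoeffs⇒All0≤ (⌜higherCoeffs⌝ 𝕡 𝕢) (q ∷ d ∷ []) _ (0≤q ∷ 0≤d ∷ []))
  where
    𝕢 𝕡 : Polynomial 2
    𝕢 = var zero
    𝕡 = con (+ 8) :* 𝕢 :+ var (suc zero)
    p≡ : ⟦ 𝕡 ⟧ (q ∷ d ∷ []) ≡ + 8 * q + d
    p≡ = refl

coefficient-signs : ∀ {p q} → 0ℤ ≤ q → + 8 * q ≤ p → c₀ p q ≤ 0ℤ × All (0ℤ ≤_) (higherCoeffs p q)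
coefficient-signs {q = q} 0≤q 8q≤p =
  ≤-elim 8q≤p (λ p → c₀ p q ≤ 0ℤ × All (0ℤ ≤_) (higherCoeffs p q))
    (λ d 0≤d → coefficient-signs-certificate q d 0≤q 0≤d)

Q-negative-at-pivot-certificate : ∀ a g → 0ℤ ≤ a → 0ℤ ≤ g →
                                  let q = 1ℤ + a ; p = + 8 * q + g in Q p q (p ^ 2 + pivot p q) < 0ℤ
Q-negative-at-pivot-certificate a g 0≤a 0≤g =
  subst₂ (λ p q → Q p q (p ^ 2 + pivot p q) < 0ℤ) p≡ q≡
    (nonNegCoeffs⇒< (⌜Q⌝ 𝕡 𝕢 (𝕡 :^ 2 :+ ⌜pivot⌝ 𝕡 𝕢)) (con 0ℤ) (a ∷ g ∷ []) _ (0≤a ∷ 0≤g ∷ []))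
  where
    𝕢 𝕡 : Polynomial 2
    𝕢 = con 1ℤ :+ var zero
    𝕡 = con (+ 8) :* 𝕢 :+ var (suc zero)
    q≡ : ⟦ 𝕢 ⟧ (a ∷ g ∷ []) ≡ 1ℤ + a
    q≡ = refl
    p≡ : ⟦ 𝕡 ⟧ (a ∷ g ∷ []) ≡ + 8 * (1ℤ + a) + g
    p≡ = refl

Q-negative-at-pivot : ∀ {p q} → 1ℤ ≤ q → + 8 * q ≤ p → Q p q (p ^ 2 + pivot p q) < 0ℤ
Q-negative-at-pivot 1≤q 8q≤p =
  ≤-elim² (+ 8 *_) (λ p q → Q p q (p ^ 2 + pivot p q) < 0ℤ) 1≤q 8q≤p Q-negative-at-pivot-certificate

Q-positive-after-pivot-certificate : ∀ a g → 0ℤ ≤ a → 0ℤ ≤ g →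
                                     let q = 1ℤ + a ; p = pMin q + g in 0ℤ < Q p q (p ^ 2 + sucℤ (pivot p q))
Q-positive-after-pivot-certificate a g 0≤a 0≤g =
  subst₂ (λ p q → 0ℤ < Q p q (p ^ 2 + sucℤ (pivot p q))) p≡ q≡
    (nonNegCoeffs⇒< (con 0ℤ) (⌜Q⌝ 𝕡 𝕢 (𝕡 :^ 2 :+ (con 1ℤ :+ ⌜pivot⌝ 𝕡 𝕢))) (a ∷ g ∷ []) _ (0≤a ∷ 0≤g ∷ []))
  where
    𝕢 𝕡 : Polynomial 2
    𝕢 = con 1ℤ :+ var zero
    𝕡 = ⌜pMin⌝ 𝕢 :+ var (suc zero)
    q≡ : ⟦ 𝕢 ⟧ (a ∷ g ∷ []) ≡ 1ℤ + a
    q≡ = refl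
    p≡ : ⟦ 𝕡 ⟧ (a ∷ g ∷ []) ≡ pMin (1ℤ + a) + g
    p≡ = refl

Q-positive-after-pivot : ∀ {p q} → 1ℤ ≤ q → pMin q ≤ p → 0ℤ < Q p q (p ^ 2 + sucℤ (pivot p q))
Q-positive-after-pivot 1≤q pMin≤p =
  ≤-elim² pMin (λ p q → 0ℤ < Q p q (p ^ 2 + sucℤ (pivot p q))) 1≤q pMin≤p Q-positive-after-pivot-certificate

cuboidInequality-fails-certificate : ∀ a g u → 0ℤ ≤ a → 0ℤ ≤ g → 0ℤ ≤ u →
  let q = 1ℤ + a ; p = pMin q + g ; t = p ^ 2 + (sucℤ (sucℤ (pivot p q)) + u) in
  (p ^ 2 + t) * (p * q + t) ≤ + 2 * t ^ 2
cuboidInequality-fails-certificate a g u 0≤a 0≤g 0≤u =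
  subst₂ (λ p q → let t = p ^ 2 + (sucℤ (sucℤ (pivot p q)) + u) in (p ^ 2 + t) * (p * q + t) ≤ + 2 * t ^ 2) p≡ q≡
    (nonNegCoeffs⇒≤ ((𝕡 :^ 2 :+ 𝕥) :* (𝕡 :* 𝕢 :+ 𝕥)) (con (+ 2) :* 𝕥 :^ 2) (a ∷ g ∷ u ∷ []) _ (0≤a ∷ 0≤g ∷ 0≤u ∷ []))
  where
    𝕢 𝕡 𝕥 : Polynomial 3
    𝕢 = con 1ℤ :+ var zero
    𝕡 = ⌜pMin⌝ 𝕢 :+ var (suc zero)
    𝕥 = 𝕡 :^ 2 :+ ((con 1ℤ :+ (con 1ℤ :+ ⌜pivot⌝ 𝕡 𝕢)) :+ var (suc (suc zero)))
    q≡ : ⟦ 𝕢 ⟧ (a ∷ g ∷ u ∷ []) ≡ 1ℤ + a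
    q≡ = refl
    p≡ : ⟦ 𝕡 ⟧ (a ∷ g ∷ u ∷ []) ≡ pMin (1ℤ + a) + g
    p≡ = refl

cuboidInequality-fails : ∀ {p q} → 1ℤ ≤ q → pMin q ≤ p → ∀ {s} → sucℤ (sucℤ (pivot p q)) ≤ s →
                         (p ^ 2 + (p ^ 2 + s)) * (p * q + (p ^ 2 + s)) ≤ + 2 * (p ^ 2 + s) ^ 2
cuboidInequality-fails 1≤q pMin≤p =
  ≤-elim² pMin (λ p q → ∀ {s} → sucℤ (sucℤ (pivot p q)) ≤ s → Fails p q s) 1≤q pMin≤p
    (λ a g 0≤a 0≤g s≥ → ≤-elim s≥ (Fails (pMin (1ℤ + a) + g) (1ℤ + a))
                          (λ u 0≤u → cuboidInequality-fails-certificate a g u 0≤a 0≤g 0≤u))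
  where
    Fails : ℤ → ℤ → ℤ → Set
    Fails p q s = (p ^ 2 + (p ^ 2 + s)) * (p * q + (p ^ 2 + s)) ≤ + 2 * (p ^ 2 + s) ^ 2

cuboidInequality⇒s≤pivot+1 : ∀ {p q s} → 1ℤ ≤ q → pMin q ≤ p →
                             + 2 * (p ^ 2 + s) ^ 2 < (p ^ 2 + (p ^ 2 + s)) * (p * q + (p ^ 2 + s)) →
                             s ≤ sucℤ (pivot p q)
cuboidInequality⇒s≤pivot+1 {p} {q} {s} 1≤q pMin≤p cuboid with s ≤? sucℤ (pivot p q)
... | yes s≤pivot+1 = s≤pivot+1
... | no  s≰pivot+1 =
  ⊥-elim (<-irrefl refl (<-≤-trans cuboid (cuboidInequality-fails 1≤q pMin≤p (i<j⇒suc[i]≤j (≰⇒> s≰pivot+1)))))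

8q≤pMin : ∀ {q} → + 2 ≤ q → + 8 * q ≤ pMin q
8q≤pMin 2≤q = ≤-elim 2≤q (λ q → + 8 * q ≤ pMin q)
  (λ a 0≤a → nonNegCoeffs⇒≤ (con (+ 8) :* (con (+ 2) :+ var zero)) (⌜pMin⌝ (con (+ 2) :+ var zero)) (a ∷ []) _ (0≤a ∷ []))

Q-no-root-above-pMin : ∀ {p q s} → + 2 ≤ q → pMin q ≤ p → 0ℤ < s → s ≤ sucℤ (pivot p q) → Q p q (p ^ 2 + s) ≢ 0ℤ
Q-no-root-above-pMin {p} {q} {s} 2≤q pMin≤p 0<s s≤pivot+1 = [ below-pivot , after-pivot ]′ (≤-suc-cases s≤pivot+1)
  where
    1≤q : 1ℤ ≤ q
    1≤q = ≤-trans (+≤+ (s≤s z≤n)) 2≤q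
    8q≤p : + 8 * q ≤ p
    8q≤p = ≤-trans (8q≤pMin 2≤q) pMin≤p
    below-pivot : s ≤ pivot p q → Q p q (p ^ 2 + s) ≢ 0ℤ
    below-pivot s≤pivot =
      let c₀≤0 , 0≤cs = coefficient-signs (≤-trans (+≤+ z≤n) 2≤q) 8q≤p
      in <⇒≢ (subst (_< 0ℤ) (sym (Q-shift p q s))
           (horner-negative-below {c₁ = c₁ p q} c₀≤0 0≤cs 0<s s≤pivot
             (subst (_< 0ℤ) (Q-shift p q (pivot p q)) (Q-negative-at-pivot 1≤q 8q≤p))))
    after-pivot : s ≡ sucℤ (pivot p q) → Q p q (p ^ 2 + s) ≢ 0ℤ
    after-pivot refl = ≢-sym (<⇒≢ (Q-positive-after-pivot 1≤q pMin≤p))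

no-root-upTo : ∀ p q B → True (allUpTo? (λ n → ¬? (Q p q (p ^ 2 + + n) ≟ 0ℤ)) (suc B)) →
               ∀ {s} → 0ℤ ≤ s → s ≤ + B → Q p q (p ^ 2 + s) ≢ 0ℤ
no-root-upTo p q B none {+ n} _ (+≤+ n≤B) = toWitness none (s≤s n≤B)

Q-no-root-q≡1 : ∀ {p s} → 3 ℕ.< p → p ℕ.< 7 → 0ℤ < s → s ≤ sucℤ (pivot (+ p) 1ℤ) →
                Q (+ p) 1ℤ ((+ p) ^ 2 + s) ≢ 0ℤ
Q-no-root-q≡1 {4} _ _ 0<s = no-root-upTo (+ 4) 1ℤ 7 _ (<⇒≤ 0<s)
Q-no-root-q≡1 {5} _ _ 0<s = no-root-upTo (+ 5) 1ℤ 9 _ (<⇒≤ 0<s)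
Q-no-root-q≡1 {6} _ _ 0<s = no-root-upTo (+ 6) 1ℤ 11 _ (<⇒≤ 0<s)
Q-no-root-q≡1 {0} ()
Q-no-root-q≡1 {1} (s≤s ())
Q-no-root-q≡1 {2} (s≤s (s≤s ()))
Q-no-root-q≡1 {3} (s≤s (s≤s (s≤s ())))
Q-no-root-q≡1 {suc (suc (suc (suc (suc (suc (suc _))))))} _ (s≤s (s≤s (s≤s (s≤s (s≤s (s≤s (s≤s ())))))))

Q-no-root : ∀ {p q s} → 0 ℕ.< q → pMin (+ q) ≤ + p → + p < + 5 * (+ q) ^ 3 + + 2 * (+ q) →
            0ℤ < s → s ≤ sucℤ (pivot (+ p) (+ q)) → Q (+ p) (+ q) ((+ p) ^ 2 + s) ≢ 0ℤ
Q-no-root {q = 1}           _ pMin≤p p<7 = Q-no-root-q≡1 (drop‿+≤+ pMin≤p) (drop‿+<+ p<7)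
Q-no-root {q = suc (suc _)} _ pMin≤p _   = Q-no-root-above-pMin (+≤+ (s≤s (s≤s z≤n))) pMin≤p

theorem9p2 : (p q : ℕ) → 0 Data.Nat.< p → 0 Data.Nat.< q → p ≢ q → Coprime p q
    → (+ 3600) ^ 3 * (+ 5 * (+ q) ^ 3) - (+ q) ^ 3 ≤ (+ 3600) ^ 3 * (+ p)
    → (+ 3600) ^ 3 * (+ p) ≤ (+ 3600) ^ 3 * (+ 5 * (+ q) ^ 3) + (+ q) ^ 3
    → + 5 * (+ q) ^ 3 - + 2 * (+ q) < + p
    → + p < + 5 * (+ q) ^ 3 + + 2 * (+ q)
    → (t : ℕ) → 0 Data.Nat.< t → ¬ ProducesCuboid p q t
theorem9p2 p q _ 0<q _ _ _ _ above below t _ (Q≡0 , p²<t , _ , _ , cuboid) =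
  Q-no-root 0<q pMin≤p below 0<s s≤pivot+1 (subst (λ t → Q (+ p) (+ q) t ≡ 0ℤ) t≡p²+s Q≡0)
  where
    s : ℤ
    s = + t - (+ p) ^ 2
    t≡p²+s : + t ≡ (+ p) ^ 2 + s
    t≡p²+s = solve 2 (λ t p² → t := p² :+ (t :- p²)) refl (+ t) ((+ p) ^ 2)
    0<s : 0ℤ < s
    0<s = i<j⇒0<j-i p²<t
    pMin≤p : pMin (+ q) ≤ + p
    pMin≤p = i<j⇒suc[i]≤j above
    s≤pivot+1 : s ≤ sucℤ (pivot (+ p) (+ q))
    s≤pivot+1 = cuboidInequality⇒s≤pivot+1 (+≤+ 0<q) pMin≤p
                  (subst (λ t → + 2 * t ^ 2 < ((+ p) ^ 2 + t) * ((+ p) * (+ q) + t)) t≡p²+s cuboid)
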